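{- Let $p$ be a prime with $p\equiv 5\pmod 8$. Then \[ f_2(p)\le \frac12\binom{p}{2}+\frac{p+3}{4}. \]
   Context: An $n$-ary $k$-radius sequence is a finite sequence $a_0,\ldots,a_{m-1}$ of elements of $\{0,\ldots,n-1\}$ such that for all distinct $x,y$ in this set there exist $i,j$ with $a_i=x$, $a_j=y$, $|i-j|\le k$; $f_k(n)$ is the shortest length of such a sequence. -}

module Defs where

open import Data.Nat using (ℕ; _≤_; ∣_-_∣)
open import Data.Fin using (Fin; toℕ)
open import Data.Vec using (Vec; lookup)
open import Data.Product using (∃-syntax; _×_)
open import Relation.Binary.PropositionalEquality using (_≡_; _≢_)

IsRadiusSeq : (n k m : ℕ) → Vec (Fin n) m → Set
IsRadiusSeq n k m a =
  (x y : Fin n) → x ≢ y →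
  ∃[ i ] ∃[ j ] (lookup a i ≡ x × lookup a j ≡ y × ∣ toℕ i - toℕ j ∣ ≤ k)

module Submission where

-- Write p = 4h + 1 = 2m + 1 (h odd).  The sequence is a walk through t
-- arithmetic progressions modulo p: block j is x_j, x_j + d_j, …, x_j + p·d_j
-- and block j + 1 starts at its last term, so there are t(p + 1) + 1 terms
-- (module Walk).  A block with invertible step d passes through every residue
-- X, putting X next to X + d and at distance 2 from X + 2d.  So it suffices
-- to find t ≤ h steps in [1, m] such that every c ∈ [1, m] is ±d or ±2d
-- (mod p) for a step d: then every pair of residues is near, and
-- 4(h(p + 1) + 1) = p² + 3 = 2·C(p, 2) + p + 3.
-- Because p ≡ 5 (mod 8), 2 is a quadratic non-residue: 2^m ≡ −1 by Gauss's
-- count (QuarterPrime.two-nonresidue).  Hence the character "c^m mod p ≤ m"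
-- takes opposite values on c and its partner d (c ≡ ±2d), and the smaller of
-- its two colour classes in [1, m] is the required set of steps
-- (QuarterPrime.DifferenceBasis).

open import Defs
open import Data.Nat using (ℕ; _+_; _*_; _≤_; _%_)
open import Data.Nat.Primality using (Prime)
open import Data.Nat.Combinatorics using (_C_)
open import Data.Product using (∃-syntax; _×_)
open import Relation.Binary.PropositionalEquality using (_≡_)

open import Data.Nat.Combinatorics using (nCk+nC[k+1]≡[n+1]C[k+1]; nC1≡n)
open import Data.Nat
open import Data.Nat.Properties
open import Data.Nat.DivMod
open import Data.Nat.Divisibility using (_∣_; n∣m*n; divides; ∣⇒≤; m%n≡0⇒n∣m; n∣m⇒m%n≡0)
open import Data.Nat.Primality using (euclidsLemma; prime⇒nonTrivial)
open import Data.Nat.Coprimality using (prime⇒coprime; coprime-Bézout)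
open import Data.Nat.GCD using (module Bézout)
open import Data.Nat.Tactic.RingSolver using (solve-∀)
open import Data.Product using (_,_; proj₁; proj₂)
open import Data.Sum using (_⊎_; inj₁; inj₂; [_,_]; swap)
open import Data.Bool using (Bool; true; false; not; T)
open import Data.Unit using (tt)
open import Data.List using (List; []; _∷_; length; filterᵇ; applyUpTo)
open import Data.List.Properties using (length-applyUpTo)
open import Data.List.Membership.Propositional using (_∈_)
open import Data.List.Relation.Unary.Any using (here; there)
open import Data.List.Membership.Propositional.Properties using (∈-filter⁺; ∈-filter⁻; ∈-applyUpTo⁺; ∈-applyUpTo⁻)
open import Function using (_∘_)
open import Data.Fin using (Fin; toℕ; fromℕ<)
open import Data.Fin.Properties using (toℕ-fromℕ<; toℕ-injective; toℕ<n)
open import Data.Vec using (Vec; tabulate; lookup)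
open import Data.Vec.Properties using (lookup∘tabulate)
open import Data.Empty using (⊥-elim)
open import Relation.Nullary using (¬_; Dec; yes; no; does)
open import Relation.Nullary.Decidable using (T?)
open import Relation.Binary using (IsEquivalence; Setoid; tri<; tri≈; tri>)
open import Relation.Binary.PropositionalEquality using (_≢_; refl; sym; trans; cong; cong₂; subst; module ≡-Reasoning)
import Relation.Binary.Reasoning.Setoid as SetoidReasoning

^-distribʳ-* : ∀ x y j → (x * y) ^ j ≡ x ^ j * y ^ j
^-distribʳ-* x y zero    = refl
^-distribʳ-* x y (suc j) = trans (cong (x * y *_) (^-distribʳ-* x y j)) (regroup x y (x ^ j) (y ^ j))
  where
  regroup : ∀ a b c d → a * b * (c * d) ≡ a * c * (b * d)
  regroup = solve-∀

double-choose-2 : ∀ k → 2 * (suc k C 2) ≡ suc k * k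
double-choose-2 zero    = refl
double-choose-2 (suc k) = begin
  2 * (suc (suc k) C 2)         ≡⟨ cong (2 *_) (nCk+nC[k+1]≡[n+1]C[k+1] (suc k) 1) ⟨
  2 * (suc k C 1 + suc k C 2)   ≡⟨ cong (λ z → 2 * (z + suc k C 2)) (nC1≡n (suc k)) ⟩
  2 * (suc k + suc k C 2)       ≡⟨ *-distribˡ-+ 2 (suc k) (suc k C 2) ⟩
  2 * suc k + 2 * (suc k C 2)   ≡⟨ cong (2 * suc k +_) (double-choose-2 k) ⟩
  2 * suc k + suc k * k         ≡⟨ factor k ⟩
  suc (suc k) * suc k           ∎
  where
  open ≡-Reasoning
  factor : ∀ k → 2 * suc k + suc k * k ≡ suc (suc k) * suc k
  factor = solve-∀

Π : (ℕ → ℕ) → ℕ → ℕ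
Π f zero    = 1
Π f (suc k) = Π f k * f (suc k)

Π-cong : ∀ {f g} k → (∀ j → f j ≡ g j) → Π f k ≡ Π g k
Π-cong zero    f≗g = refl
Π-cong (suc k) f≗g = cong₂ _*_ (Π-cong k f≗g) (f≗g (suc k))

Π-scale : ∀ c f k → Π (λ j → c * f j) k ≡ c ^ k * Π f k
Π-scale c f zero    = refl
Π-scale c f (suc k) = begin
  Π (λ j → c * f j) k * (c * f (suc k)) ≡⟨ cong (_* (c * f (suc k))) (Π-scale c f k) ⟩
  c ^ k * Π f k * (c * f (suc k))       ≡⟨ regroup (c ^ k) (Π f k) c (f (suc k)) ⟩
  c * c ^ k * (Π f k * f (suc k))       ∎
  where
  open ≡-Reasoning
  regroup : ∀ a b c d → a * b * (c * d) ≡ c * a * (b * d)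
  regroup = solve-∀

Π-split-reversed : ∀ g a b → Π g (a + b) ≡ Π g a * Π (λ j → g (suc (a + b) ∸ j)) b
Π-split-reversed g a zero    = trans (cong (Π g) (+-identityʳ a)) (sym (*-identityʳ _))
Π-split-reversed g a (suc b) = begin
  Π g (a + suc b)                                       ≡⟨ cong (Π g) (+-suc a b) ⟩
  Π g (suc a + b)                                       ≡⟨ Π-split-reversed g (suc a) b ⟩
  Π g a * g (suc a) * Π (λ j → g (suc (suc a + b) ∸ j)) b ≡⟨ cong (λ z → Π g a * g (suc a) * z) tail≡ ⟩
  Π g a * g (suc a) * R b                               ≡⟨ regroup (Π g a) (g (suc a)) (R b) ⟩
  Π g a * (R b * g (suc a))                             ≡⟨ cong (λ z → Π g a * (R b * g z)) last≡ ⟨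
  Π g a * R (suc b)                                     ∎
  where
  open ≡-Reasoning
  R : ℕ → ℕ
  R = Π (λ j → g (suc (a + suc b) ∸ j))
  tail≡ : Π (λ j → g (suc (suc a + b) ∸ j)) b ≡ R b
  tail≡ = Π-cong b (λ j → cong (λ z → g (suc z ∸ j)) (sym (+-suc a b)))
  last≡ : suc (a + suc b) ∸ suc b ≡ suc a
  last≡ = trans (cong (_∸ b) (+-suc a b)) (m+n∸n≡m (suc a) b)
  regroup : ∀ x y z → x * y * z ≡ x * (z * y)
  regroup = solve-∀

double odd : ℕ → ℕ
double j = 2 * j
odd    j = 2 * j ∸ 1

Π-odd-even : ∀ k → Π (λ j → j) (k + k) ≡ Π odd k * Π double k
Π-odd-even zero    = refl
Π-odd-even (suc k) = begin
  Π (λ j → j) (suc k + suc k)                          ≡⟨ cong (Π (λ j → j)) (cong suc (+-suc k k)) ⟩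
  Π (λ j → j) (k + k) * suc (k + k) * suc (suc (k + k)) ≡⟨ cong (λ z → z * suc (k + k) * suc (suc (k + k))) (Π-odd-even k) ⟩
  Π odd k * Π double k * suc (k + k) * suc (suc (k + k)) ≡⟨ regroup (Π odd k) (Π double k) k ⟩
  Π odd k * suc (k + k) * (Π double k * double (suc k)) ≡⟨ cong (λ z → Π odd k * z * (Π double k * double (suc k))) odd≡ ⟨
  Π odd (suc k) * Π double (suc k)                      ∎
  where
  open ≡-Reasoning
  regroup : ∀ a b k → a * b * suc (k + k) * suc (suc (k + k)) ≡ a * suc (k + k) * (b * (2 * suc k))
  regroup = solve-∀
  odd≡ : odd (suc k) ≡ suc (k + k)
  odd≡ = cong (_∸ 1) (double-suc k)
    where
    double-suc : ∀ k → 2 * suc k ≡ suc (suc (k + k))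
    double-suc = solve-∀

complementary : ∀ {A B : Set} (a? : Dec A) (b? : Dec B) → (A → ¬ B) → (¬ A → B) →
                does b? ≡ not (does a?)
complementary (yes a) (yes b) a⇒¬b ¬a⇒b = ⊥-elim (a⇒¬b a b)
complementary (yes a) (no ¬b) a⇒¬b ¬a⇒b = refl
complementary (no ¬a) (yes b) a⇒¬b ¬a⇒b = refl
complementary (no ¬a) (no ¬b) a⇒¬b ¬a⇒b = ⊥-elim (¬b (¬a⇒b ¬a))

colour-classes : ∀ {A : Set} (f : A → Bool) xs →
                 length (filterᵇ f xs) + length (filterᵇ (not ∘ f) xs) ≡ length xs
colour-classes f []       = refl
colour-classes f (x ∷ xs) with f x
... | true  = cong suc (colour-classes f xs)
... | false = trans (+-suc _ _) (cong suc (colour-classes f xs))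

-- The j-th element of a list of numbers (0 past its end).
nth : List ℕ → ℕ → ℕ
nth []       j       = 0
nth (x ∷ xs) zero    = x
nth (x ∷ xs) (suc j) = nth xs j

∈⇒nth : ∀ {d} xs → d ∈ xs → ∃[ j ] (j < length xs × nth xs j ≡ d)
∈⇒nth (x ∷ xs) (here refl) = 0 , s≤s z≤n , refl
∈⇒nth (x ∷ xs) (there d∈xs) with ∈⇒nth xs d∈xs
... | j , j<len , nth≡d = suc j , s≤s j<len , nth≡d

-- Arithmetic modulo n = k + 1.  Writing the modulus as a successor keeps the
-- NonZero instance automatic and gives a name, k, to the residue −1.
module Congruence (k : ℕ) where

  n : ℕ
  n = suc k

  infix 4 _≈_
  -- a ≈ b means a ≡ b (mod n); a record, so that a and b stay inferable.
  record _≈_ (a b : ℕ) : Set where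
    constructor mk
    field remainders : a % n ≡ b % n

  ≈-isEquivalence : IsEquivalence _≈_
  ≈-isEquivalence = record
    { refl  = mk refl
    ; sym   = λ (mk e) → mk (sym e)
    ; trans = λ (mk e) (mk f) → mk (trans e f)
    }

  ≈-setoid : Setoid _ _
  ≈-setoid = record { isEquivalence = ≈-isEquivalence }

  open IsEquivalence ≈-isEquivalence public
    using () renaming (refl to ≈-refl; sym to ≈-sym; trans to ≈-trans)
  module ≈-Reasoning = SetoidReasoning ≈-setoid

  ≡⇒≈ : ∀ {a b} → a ≡ b → a ≈ b
  ≡⇒≈ refl = ≈-refl

  +-cong : ∀ {a b c d} → a ≈ b → c ≈ d → a + c ≈ b + d
  +-cong {a} {b} {c} {d} (mk e₁) (mk e₂) = mk (begin
    (a + c) % n           ≡⟨ %-distribˡ-+ a c n ⟩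
    (a % n + c % n) % n   ≡⟨ cong₂ (λ x y → (x + y) % n) e₁ e₂ ⟩
    (b % n + d % n) % n   ≡⟨ %-distribˡ-+ b d n ⟨
    (b + d) % n           ∎)
    where open ≡-Reasoning

  *-cong : ∀ {a b c d} → a ≈ b → c ≈ d → a * c ≈ b * d
  *-cong {a} {b} {c} {d} (mk e₁) (mk e₂) = mk (begin
    (a * c) % n             ≡⟨ %-distribˡ-* a c n ⟩
    (a % n * (c % n)) % n   ≡⟨ cong₂ (λ x y → (x * y) % n) e₁ e₂ ⟩
    (b % n * (d % n)) % n   ≡⟨ %-distribˡ-* b d n ⟨
    (b * d) % n             ∎)
    where open ≡-Reasoning

  +-congˡ : ∀ a {c d} → c ≈ d → a + c ≈ a + d
  +-congˡ a = +-cong (≈-refl {a})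

  *-congˡ : ∀ a {c d} → c ≈ d → a * c ≈ a * d
  *-congˡ a = *-cong (≈-refl {a})

  ^-cong : ∀ {a b} j → a ≈ b → a ^ j ≈ b ^ j
  ^-cong zero    a≈b = ≈-refl
  ^-cong (suc j) a≈b = *-cong a≈b (^-cong j a≈b)

  Π-congₘ : ∀ {f g} j → (∀ i → 0 < i → i ≤ j → f i ≈ g i) → Π f j ≈ Π g j
  Π-congₘ zero    f≈g = ≈-refl
  Π-congₘ (suc j) f≈g =
    *-cong (Π-congₘ j (λ i 0<i i≤j → f≈g i 0<i (m≤n⇒m≤1+n i≤j))) (f≈g (suc j) (s≤s z≤n) ≤-refl)

  +-multiple : ∀ a j → a + j * n ≈ a
  +-multiple a j = mk ([m+kn]%n≡m%n a j n)

  multiple≈0 : ∀ j → j * n ≈ 0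
  multiple≈0 j = +-multiple 0 j

  n≈0 : n ≈ 0
  n≈0 = mk (n%n≡0 n)

  +-modulus : ∀ a → a + n ≈ a
  +-modulus a = ≈-trans (+-congˡ a n≈0) (≡⇒≈ (+-identityʳ a))

  +-k* : ∀ c → c + k * c ≈ 0
  +-k* c = ≈-trans (≡⇒≈ (*-comm n c)) (multiple≈0 c)

  +-cancelʳ : ∀ {a b} c → a + c ≈ b + c → a ≈ b
  +-cancelʳ {a} {b} c a+c≈b+c = begin
    a                 ≡⟨ +-identityʳ a ⟨
    a + 0             ≈⟨ +-congˡ a (+-k* c) ⟨
    a + (c + k * c)   ≡⟨ +-assoc a c (k * c) ⟨
    a + c + k * c     ≈⟨ +-cong a+c≈b+c (≈-refl {k * c}) ⟩
    b + c + k * c     ≡⟨ +-assoc b c (k * c) ⟩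
    b + (c + k * c)   ≈⟨ +-congˡ b (+-k* c) ⟩
    b + 0             ≡⟨ +-identityʳ b ⟩
    b                 ∎
    where open ≈-Reasoning

  inverse-unique : ∀ {a b c} → a + c ≈ 0 → b + c ≈ 0 → a ≈ b
  inverse-unique {c = c} a+c≈0 b+c≈0 = +-cancelʳ c (≈-trans a+c≈0 (≈-sym b+c≈0))

  *-annihilate : ∀ a {b} → b ≈ 0 → a * b ≈ 0
  *-annihilate a b≈0 = ≈-trans (*-congˡ a b≈0) (≡⇒≈ (*-zeroʳ a))

  square-of-inverse : ∀ {x c} → x + c ≈ 0 → x ^ 2 ≈ c ^ 2
  square-of-inverse {x} {c} x+c≈0 = +-cancelʳ (x * c) (begin
    x ^ 2 + x * c   ≡⟨ factor x c ⟩
    x * (x + c)     ≈⟨ *-annihilate x x+c≈0 ⟩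
    0               ≈⟨ *-annihilate c (≈-trans (≡⇒≈ (+-comm c x)) x+c≈0) ⟨
    c * (c + x)     ≡⟨ expand c x ⟩
    c ^ 2 + x * c   ∎)
    where
    open ≈-Reasoning
    factor : ∀ x c → x * (x * 1) + x * c ≡ x * (x + c)
    factor = solve-∀
    expand : ∀ c x → c * (c + x) ≡ c * (c * 1) + x * c
    expand = solve-∀

  even-power-of-inverse : ∀ {x c} j → x + c ≈ 0 → x ^ (j + j) ≈ c ^ (j + j)
  even-power-of-inverse {x} {c} j x+c≈0 = begin
    x ^ (j + j)   ≡⟨ cong (x ^_) j+j≡2*j ⟩
    x ^ (2 * j)   ≡⟨ ^-*-assoc x 2 j ⟨
    (x ^ 2) ^ j   ≈⟨ ^-cong j (square-of-inverse {x} {c} x+c≈0) ⟩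
    (c ^ 2) ^ j   ≡⟨ ^-*-assoc c 2 j ⟩
    c ^ (2 * j)   ≡⟨ cong (c ^_) j+j≡2*j ⟨
    c ^ (j + j)   ∎
    where
    open ≈-Reasoning
    j+j≡2*j : j + j ≡ 2 * j
    j+j≡2*j = cong (j +_) (sym (+-identityʳ j))

  k+1≈0 : k + 1 ≈ 0
  k+1≈0 = ≈-trans (≡⇒≈ (+-comm k 1)) n≈0

  k*k≈1 : k * k ≈ 1
  k*k≈1 = ≈-trans (≡⇒≈ (cong (k *_) (sym (*-identityʳ k)))) (square-of-inverse k+1≈0)

  k^odd : ∀ j → k ^ suc (j + j) ≈ k
  k^odd j = begin
    k * k ^ (j + j)  ≈⟨ *-congˡ k (even-power-of-inverse j k+1≈0) ⟩
    k * 1 ^ (j + j)  ≡⟨ cong (k *_) (^-zeroˡ (j + j)) ⟩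
    k * 1            ≡⟨ *-identityʳ k ⟩
    k                ∎
    where open ≈-Reasoning

  Invertible : ℕ → Set
  Invertible d = ∃[ u ] (u * d ≈ 1)

  solve-linear : ∀ {d} → Invertible d → ∀ S T → ∃[ l ] (l < n × S + l * d ≈ T)
  solve-linear {d} (u , u*d≈1) S T = v % n , m%n<n v n , (begin
    S + v % n * d       ≈⟨ +-congˡ S (*-cong {v % n} {v} (mk (m%n%n≡m%n v n)) (≈-refl {d})) ⟩
    S + v * d           ≡⟨ cong (S +_) (*-comm (u * w) d) ⟩
    S + d * (u * w)     ≡⟨ cong (S +_) (shuffle d u w) ⟩
    S + w * (u * d)     ≈⟨ +-congˡ S (*-congˡ w u*d≈1) ⟩
    S + w * 1           ≡⟨ rearrange S T k ⟩
    T + (S + k * S)     ≈⟨ +-congˡ T (+-k* S) ⟩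
    T + 0               ≡⟨ +-identityʳ T ⟩
    T                   ∎)
    where
    open ≈-Reasoning
    w = T + k * S
    v = u * w
    shuffle : ∀ d u w → d * (u * w) ≡ w * (u * d)
    shuffle = solve-∀
    rearrange : ∀ S T k → S + (T + k * S) * 1 ≡ T + (S + k * S)
    rearrange = solve-∀

  inverse-remainders : ∀ {a b} → ¬ n ∣ a → ¬ n ∣ b → a + b ≈ 0 → a % n + b % n ≡ n
  inverse-remainders {a} {b} n∤a n∤b (mk a+b≡0) with m%n≡0⇒n∣m (a % n + b % n) n sum%n≡0
    where
    sum%n≡0 : (a % n + b % n) % n ≡ 0
    sum%n≡0 = trans (sym (%-distribˡ-+ a b n)) a+b≡0
  ... | divides zero s≡0 = ⊥-elim (n∤a (m%n≡0⇒n∣m a n (m+n≡0⇒m≡0 (a % n) s≡0)))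
  ... | divides (suc zero) s≡n = trans s≡n (+-identityʳ n)
  ... | divides (suc (suc r)) s≡n+n+rn = ⊥-elim (<⇒≱ s<n+n (begin
    n + n              ≤⟨ +-monoʳ-≤ n (m≤m+n n (r * n)) ⟩
    n + (n + r * n)    ≡⟨ s≡n+n+rn ⟨
    a % n + b % n      ∎))
    where
    open ≤-Reasoning
    s<n+n : a % n + b % n < n + n
    s<n+n = +-mono-< (m%n<n a n) (m%n<n b n)

  module PrimeModulus (n-prime : Prime n) where

    ∤-positive : ∀ {c} → 0 < c → c < n → ¬ n ∣ c
    ∤-positive {suc c} _ c<n n∣c = <⇒≱ c<n (∣⇒≤ n∣c)

    ∤-* : ∀ {a b} → ¬ n ∣ a → ¬ n ∣ b → ¬ n ∣ a * b
    ∤-* {a} {b} n∤a n∤b n∣ab with euclidsLemma a b n-prime n∣ab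
    ... | inj₁ n∣a = n∤a n∣a
    ... | inj₂ n∣b = n∤b n∣b

    ∤-1 : ¬ n ∣ 1
    ∤-1 = ∤-positive (s≤s z≤n) (nonTrivial⇒n>1 n {{prime⇒nonTrivial n-prime}})

    ∤-^ : ∀ {c} j → ¬ n ∣ c → ¬ n ∣ c ^ j
    ∤-^ zero    n∤c = ∤-1
    ∤-^ (suc j) n∤c = ∤-* n∤c (∤-^ j n∤c)

    cancel-factor : ∀ {a c} → ¬ n ∣ c → a * c ≈ 0 → a ≈ 0
    cancel-factor {a} {c} n∤c (mk ac≡0) with euclidsLemma a c n-prime (m%n≡0⇒n∣m (a * c) n ac≡0)
    ... | inj₁ n∣a = mk (n∣m⇒m%n≡0 a n n∣a)
    ... | inj₂ n∣c = ⊥-elim (n∤c n∣c)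

    -- Every 0 < d < n is invertible: this is Bézout's identity for gcd(n, d) = 1.
    invertible : ∀ {d} → 0 < d → d < n → Invertible d
    invertible {d@(suc _)} _ d<n with coprime-Bézout (prime⇒coprime n-prime d<n)
    ... | Bézout.-+ x y 1+xn≡yd = y , (begin
      y * d       ≡⟨ 1+xn≡yd ⟨
      1 + x * n   ≈⟨ +-multiple 1 x ⟩
      1           ∎)
      where open ≈-Reasoning
    ... | Bézout.+- x y 1+yd≡xn = k * y , (begin
      k * y * d   ≡⟨ *-assoc k y d ⟩
      k * (y * d) ≈⟨ *-congˡ k y*d≈k ⟩
      k * k       ≈⟨ k*k≈1 ⟩
      1           ∎)
      where
      open ≈-Reasoning
      y*d+1≈0 : y * d + 1 ≈ 0
      y*d+1≈0 = ≈-trans (≡⇒≈ (trans (+-comm (y * d) 1) 1+yd≡xn)) (multiple≈0 x)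
      y*d≈k : y * d ≈ k
      y*d≈k = inverse-unique y*d+1≈0 k+1≈0

    ∤-Π : ∀ f j → (∀ i → 0 < i → i ≤ j → ¬ n ∣ f i) → ¬ n ∣ Π f j
    ∤-Π f zero    n∤f = ∤-1
    ∤-Π f (suc j) n∤f =
      ∤-* (∤-Π f j (λ i 0<i i≤j → n∤f i 0<i (m≤n⇒m≤1+n i≤j))) (n∤f (suc j) (s≤s z≤n) ≤-refl)

Near : ∀ {n M} → Vec (Fin n) M → Fin n → Fin n → Set
Near a x y = ∃[ i ] ∃[ j ] (lookup a i ≡ x × lookup a j ≡ y × ∣ toℕ i - toℕ j ∣ ≤ 2)

near-sym : ∀ {n M} {a : Vec (Fin n) M} {x y} → Near a x y → Near a y x
near-sym (i , j , aᵢ≡x , aⱼ≡y , close) = j , i , aⱼ≡y , aᵢ≡x , subst (_≤ 2) (∣-∣-comm (toℕ i) (toℕ j)) close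

-- A walk through t arithmetic progressions modulo n = k + 1.  Block j lists
--   first j + l · step j   for l = 0, …, n
-- with first (j + 1) = first j + step j.  The last term of block j is
-- first j + (n + 1)·step j ≡ first (j + 1), the first term of block j + 1, so
-- the blocks share their end points and the walk has t(n + 1) + 1 terms.
module Walk (k t : ℕ) (step : ℕ → ℕ) where

  open Congruence k

  N : ℕ
  N = suc n

  first : ℕ → ℕ
  first zero    = 0
  first (suc j) = first j + step j

  value : ℕ → ℕ
  value i = first (i / N) + i % N * step (i / N)

  size : ℕ
  size = suc (t * N)

  term : Fin size → Fin n
  term i = fromℕ< (m%n<n (value (toℕ i)) n)

  walk : Vec (Fin n) size
  walk = tabulate term

  value-in-block : ∀ j l → l ≤ N → value (l + j * N) ≈ first j + l * step j
  value-in-block j l l≤N with m≤n⇒m<n∨m≡n l≤N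
  ... | inj₁ l<N = ≡⇒≈ (cong₂ (λ q r → first q + r * step q) quotient remainder)
    where
    quotient : (l + j * N) / N ≡ j
    quotient = trans (+-distrib-/-∣ʳ l (n∣m*n j)) (cong₂ _+_ (m<n⇒m/n≡0 l<N) (m*n/n≡m j N))
    remainder : (l + j * N) % N ≡ l
    remainder = trans ([m+kn]%n≡m%n l j N) (m<n⇒m%n≡m l<N)
  ... | inj₂ refl = begin
    value (suc j * N)                    ≡⟨ cong₂ (λ q r → first q + r * step q) (m*n/n≡m (suc j) N) (m*n%n≡0 (suc j) N) ⟩
    first j + step j + 0                 ≡⟨ +-identityʳ _ ⟩
    first j + step j                     ≈⟨ +-multiple (first j + step j) (step j) ⟨
    first j + step j + step j * n        ≡⟨ regroup (first j) (step j) n ⟩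
    first j + N * step j                 ∎
    where
    open ≈-Reasoning
    regroup : ∀ a s n → a + s + s * n ≡ a + suc n * s
    regroup = solve-∀

  in-walk : ∀ {j l} → j < t → l ≤ N → l + j * N < size
  in-walk {j} j<t l≤N = s≤s (≤-trans (+-monoˡ-≤ (j * N) l≤N) (*-monoˡ-≤ N j<t))

  lookup-walk : ∀ {i} (i<size : i < size) {x} → value i ≈ toℕ x → lookup walk (fromℕ< i<size) ≡ x
  lookup-walk {i} i<size {x} (mk value≡x) = begin
    lookup walk (fromℕ< i<size)                                   ≡⟨ lookup∘tabulate term (fromℕ< i<size) ⟩
    fromℕ< (m%n<n (value (toℕ (fromℕ< i<size))) n)               ≡⟨ toℕ-injective toℕ≡ ⟩
    x                                                             ∎
    where
    open ≡-Reasoning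
    toℕ≡ : toℕ (fromℕ< (m%n<n (value (toℕ (fromℕ< i<size))) n)) ≡ toℕ x
    toℕ≡ = begin
      toℕ (fromℕ< (m%n<n (value (toℕ (fromℕ< i<size))) n)) ≡⟨ toℕ-fromℕ< _ ⟩
      value (toℕ (fromℕ< i<size)) % n                     ≡⟨ cong (λ z → value z % n) (toℕ-fromℕ< i<size) ⟩
      value i % n                                         ≡⟨ value≡x ⟩
      toℕ x % n                                           ≡⟨ m<n⇒m%n≡m (toℕ<n x) ⟩
      toℕ x                                               ∎

  -- If y ≡ x + e·step j with e ≤ 2 and step j invertible, then block j
  -- passes through x (it meets every residue) and e positions later
  -- through y.
  walk-meets : ∀ {j e} → j < t → e ≤ 2 → Invertible (step j) →
               ∀ x y → toℕ x + e * step j ≈ toℕ y → Near walk x y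
  walk-meets {j} {e} j<t e≤2 invertible x y x+e*s≈y with solve-linear invertible (first j) (toℕ x)
  ... | l , l<n , first+l*s≈x =
    fromℕ< at-x<size , fromℕ< at-y<size , lookup-walk at-x<size value≈x , lookup-walk at-y<size value≈y , close
    where
    l≤N : l ≤ N
    l≤N = ≤-trans (<⇒≤ l<n) (n≤1+n n)
    l+e≤N : l + e ≤ N
    l+e≤N = ≤-trans (+-monoʳ-≤ l e≤2) (≤-trans (≤-reflexive (+-comm l 2)) (s≤s l<n))
    at-x<size : l + j * N < size
    at-x<size = in-walk j<t l≤N
    at-y<size : l + e + j * N < size
    at-y<size = in-walk j<t l+e≤N
    value≈x : value (l + j * N) ≈ toℕ x
    value≈x = ≈-trans (value-in-block j l l≤N) first+l*s≈x
    value≈y : value (l + e + j * N) ≈ toℕ y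
    value≈y = begin
      value (l + e + j * N)                ≈⟨ value-in-block j (l + e) l+e≤N ⟩
      first j + (l + e) * step j           ≡⟨ regroup (first j) l e (step j) ⟩
      first j + l * step j + e * step j    ≈⟨ +-cong first+l*s≈x (≈-refl {e * step j}) ⟩
      toℕ x + e * step j                   ≈⟨ x+e*s≈y ⟩
      toℕ y                                ∎
      where
      open ≈-Reasoning
      regroup : ∀ a l e s → a + (l + e) * s ≡ a + l * s + e * s
      regroup = solve-∀
    close : ∣ toℕ (fromℕ< at-x<size) - toℕ (fromℕ< at-y<size) ∣ ≤ 2
    close = begin
      ∣ toℕ (fromℕ< at-x<size) - toℕ (fromℕ< at-y<size) ∣ ≡⟨ cong₂ ∣_-_∣ (toℕ-fromℕ< at-x<size) (toℕ-fromℕ< at-y<size) ⟩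
      ∣ l + j * N - (l + e + j * N) ∣                     ≡⟨ cong (∣ l + j * N -_∣) (swap-last l e (j * N)) ⟩
      ∣ l + j * N - (l + j * N + e) ∣                     ≡⟨ ∣m-m+n∣≡n (l + j * N) e ⟩
      e                                                   ≤⟨ e≤2 ⟩
      2                                                   ∎
      where
      open ≤-Reasoning
      swap-last : ∀ a b c → a + b + c ≡ a + c + b
      swap-last = solve-∀

-- The setting of the theorem: p = 4h + 1 = 2m + 1 with m = 2h.  Residues are
-- taken modulo p, so k = m + m = p − 1 plays the role of −1.
module QuarterPrime (h : ℕ) where

  m : ℕ
  m = h + h

  p : ℕ
  p = suc (m + m)

  k : ℕ
  k = m + m

  open Congruence k public

  m<p : m < p
  m<p = s≤s (m≤m+n m m)

  -- For 1 ≤ j ≤ h the double 2(m + 1 − j) lies in (m, 2m] and equals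
  -- p − (2j − 1), so it is congruent to −(2j − 1).
  reflected-double : ∀ j → 0 < j → j ≤ h → double (suc m ∸ j) ≈ k * odd j
  reflected-double (suc i) _ j≤h = inverse-unique double+odd≈0 odd+k*odd≈0
    where
    i≤m : i ≤ m
    i≤m = ≤-trans (n≤1+n i) (≤-trans j≤h (m≤m+n h h))
    identity : ∀ T i → 2 * T + (i + suc (i + 0)) ≡ suc ((T + i) + (T + i))
    identity = solve-∀
    double+odd≡p : double (m ∸ i) + odd (suc i) ≡ p
    double+odd≡p = trans (identity (m ∸ i) i) (cong (λ z → suc (z + z)) (m∸n+n≡m i≤m))
    double+odd≈0 : double (m ∸ i) + odd (suc i) ≈ 0
    double+odd≈0 = ≈-trans (≡⇒≈ double+odd≡p) n≈0
    odd+k*odd≈0 : k * odd (suc i) + odd (suc i) ≈ 0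
    odd+k*odd≈0 = ≈-trans (≡⇒≈ (+-comm (k * odd (suc i)) _)) (+-k* (odd (suc i)))

  -- Gauss's count for the residue 2: multiplying 1, …, m by 2 gives the
  -- doubles 2, 4, …, 2h (at most m) and h doubles above m, each ≡ −(odd
  -- number); together with the odd numbers up to 2h − 1 they rebuild m!:
  --   2^m · m! ≡ (−1)^h · m!.
  doubles-product : k ^ h ≈ k → 2 ^ m * Π (λ j → j) m ≈ k * Π (λ j → j) m
  doubles-product k^h≈k = begin
    2 ^ m * Π (λ j → j) m                             ≡⟨ Π-scale 2 (λ j → j) m ⟨
    Π double (h + h)                                  ≡⟨ Π-split-reversed double h h ⟩
    Π double h * Π (λ j → double (suc m ∸ j)) h       ≈⟨ *-congˡ (Π double h) (Π-congₘ h reflected-double) ⟩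
    Π double h * Π (λ j → k * odd j) h                ≡⟨ cong (Π double h *_) (Π-scale k odd h) ⟩
    Π double h * (k ^ h * Π odd h)                    ≈⟨ *-congˡ (Π double h) (*-cong k^h≈k (≈-refl {Π odd h})) ⟩
    Π double h * (k * Π odd h)                        ≡⟨ regroup (Π double h) k (Π odd h) ⟩
    k * (Π odd h * Π double h)                        ≡⟨ cong (k *_) (Π-odd-even h) ⟨
    k * Π (λ j → j) m                                 ∎
    where
    open ≈-Reasoning
    regroup : ∀ a b c → a * (b * c) ≡ b * (c * a)
    regroup = solve-∀

  -- Hence 2^m ≡ −1 (mod p): 2 is a quadratic non-residue, after cancelling m!,
  -- which p does not divide.
  two-nonresidue : Prime p → k ^ h ≈ k → 2 ^ m + 1 ≈ 0
  two-nonresidue p-prime k^h≈k = cancel-factor p∤m! (begin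
    (2 ^ m + 1) * F           ≡⟨ *-distribʳ-+ F (2 ^ m) 1 ⟩
    2 ^ m * F + 1 * F         ≈⟨ +-cong (doubles-product k^h≈k) (≈-refl {1 * F}) ⟩
    k * F + 1 * F             ≡⟨ *-distribʳ-+ F k 1 ⟨
    (k + 1) * F               ≈⟨ *-cong k+1≈0 (≈-refl {F}) ⟩
    0                         ∎)
    where
    open ≈-Reasoning
    open PrimeModulus p-prime
    F = Π (λ j → j) m
    p∤m! : ¬ p ∣ F
    p∤m! = ∤-Π (λ j → j) m (λ i 0<i i≤m → ∤-positive 0<i (≤-<-trans i≤m m<p))

  module DifferenceBasis (p-prime : Prime p) (2^m+1≈0 : 2 ^ m + 1 ≈ 0) where

    open PrimeModulus p-prime

    -- d is a partner of c when c ≡ ±2d (mod p), read in [1, m].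
    Partner : ℕ → ℕ → Set
    Partner c d = 2 * d ≡ c ⊎ 2 * d + c ≡ p

    even-or-odd : ∀ c → ∃[ r ] (c ≡ r + r ⊎ c ≡ suc (r + r))
    even-or-odd zero    = 0 , inj₁ refl
    even-or-odd (suc c) with even-or-odd c
    ... | r , inj₁ c≡2r  = r , inj₂ (cong suc c≡2r)
    ... | r , inj₂ c≡2r+1 = suc r , inj₁ (cong suc (trans c≡2r+1 (sym (+-suc r r))))

    -- Every c in [1, m] has a partner in [1, m]: c/2 if c is even, and
    -- m − (c − 1)/2 if c is odd (then 2d + c = 2m + 1).
    partner : ∀ c → 0 < c → c ≤ m → ∃[ d ] (0 < d × d ≤ m × Partner c d)
    partner c 0<c c≤m with even-or-odd c
    ... | zero , inj₁ refl = ⊥-elim (<-irrefl refl 0<c)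
    ... | r@(suc _) , inj₁ refl = r , s≤s z≤n , ≤-trans (m≤m+n r r) c≤m , inj₁ (cong (r +_) (+-identityʳ r))
    ... | r , inj₂ refl = m ∸ r , m<n⇒0<n∸m r<m , m∸n≤m m r , inj₂ 2d+c≡p
      where
      r<m : r < m
      r<m = ≤-trans (s≤s (m≤m+n r r)) c≤m
      identity : ∀ d r → 2 * d + suc (r + r) ≡ suc ((d + r) + (d + r))
      identity = solve-∀
      2d+c≡p : 2 * (m ∸ r) + suc (r + r) ≡ p
      2d+c≡p = trans (identity (m ∸ r) r) (cong (λ z → suc (z + z)) (m∸n+n≡m (<⇒≤ r<m)))

    -- Partners have opposite m-th powers, because (±2d)^m ≡ 2^m d^m ≡ −d^m.
    partner-powers : ∀ {c d} → Partner c d → c ^ m + d ^ m ≈ 0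
    partner-powers {c} {d} partnered = ≈-trans (+-cong c^m≈[2d]^m (≈-refl {d ^ m})) (begin
      (2 * d) ^ m + d ^ m     ≡⟨ cong (_+ d ^ m) (^-distribʳ-* 2 d m) ⟩
      2 ^ m * d ^ m + d ^ m   ≡⟨ factor (2 ^ m) (d ^ m) ⟩
      (2 ^ m + 1) * d ^ m     ≈⟨ *-cong 2^m+1≈0 (≈-refl {d ^ m}) ⟩
      0                       ∎)
      where
      open ≈-Reasoning
      factor : ∀ a b → a * b + b ≡ (a + 1) * b
      factor = solve-∀
      c^m≈[2d]^m : c ^ m ≈ (2 * d) ^ m
      c^m≈[2d]^m = [ (λ 2d≡c → ≡⇒≈ (cong (_^ m) (sym 2d≡c)))
                   , (λ 2d+c≡p → even-power-of-inverse h (≈-trans (≡⇒≈ (trans (+-comm c (2 * d)) 2d+c≡p)) n≈0))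
                   ] partnered

    exactly-one-small : ∀ {x y} → x + y ≡ p → does (y ≤? m) ≡ not (does (x ≤? m))
    exactly-one-small {x} {y} x+y≡p = complementary (x ≤? m) (y ≤? m) both-small both-large
      where
      both-small : x ≤ m → ¬ y ≤ m
      both-small x≤m y≤m = 1+n≰n (subst (_≤ m + m) x+y≡p (+-mono-≤ x≤m y≤m))
      p<2m+2 : p < suc m + suc m
      p<2m+2 = s≤s (≤-reflexive (sym (+-suc m m)))
      both-large : ¬ x ≤ m → y ≤ m
      both-large x≰m = ≮⇒≥ (λ m<y → <⇒≱ p<2m+2 (subst (suc m + suc m ≤_) x+y≡p (+-mono-≤ (≰⇒> x≰m) m<y)))

    -- The quadratic character: c is a residue iff c^m ≡ 1, i.e. iff the
    -- remainder of c^m is small.  Only the flip below is ever used.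
    χ : ℕ → Bool
    χ c = does (c ^ m % p ≤? m)

    χ-flips : ∀ {c d} → 0 < c → c ≤ m → 0 < d → d ≤ m → Partner c d → χ d ≡ not (χ c)
    χ-flips {c} {d} 0<c c≤m 0<d d≤m partnered = exactly-one-small {c ^ m % p} {d ^ m % p}
      (inverse-remainders (p∤power 0<c c≤m) (p∤power 0<d d≤m) (partner-powers partnered))
      where
      p∤power : ∀ {c} → 0 < c → c ≤ m → ¬ p ∣ c ^ m
      p∤power 0<c c≤m = ∤-^ m (∤-positive 0<c (≤-<-trans c≤m m<p))

    candidates : List ℕ
    candidates = applyUpTo suc m

    Flips : (ℕ → Bool) → Set
    Flips f = ∀ {c d} → 0 < c → c ≤ m → 0 < d → d ≤ m → Partner c d → f d ≡ not (f c)

    Covers : ℕ → ℕ → Set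
    Covers c d = d ≡ c ⊎ Partner c d

    in-class : ∀ f {c} → 0 < c → c ≤ m → f c ≡ true → c ∈ filterᵇ f candidates
    in-class f {suc c} _ c<m fc = ∈-filter⁺ (T? ∘ f) (∈-applyUpTo⁺ suc c<m) (subst T (sym fc) tt)

    -- A colour class of a flipping colouring covers every difference in
    -- [1, m]: c itself if it has the colour, otherwise its partner does.
    class-covers : ∀ f → Flips f → ∀ c → 0 < c → c ≤ m →
                   ∃[ d ] (d ∈ filterᵇ f candidates × Covers c d)
    class-covers f flips c 0<c c≤m with f c in fc
    ... | true  = c , in-class f 0<c c≤m fc , inj₁ refl
    ... | false with partner c 0<c c≤m
    ...   | d , 0<d , d≤m , c~d =
            d , in-class f 0<d d≤m (trans (flips 0<c c≤m 0<d d≤m c~d) (cong not fc)) , inj₂ c~d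

    class-bounds : ∀ f {d} → d ∈ filterᵇ f candidates → 0 < d × d ≤ m
    class-bounds f d∈class with ∈-filter⁻ (T? ∘ f) {xs = candidates} d∈class
    ... | d∈candidates , _ with ∈-applyUpTo⁻ suc d∈candidates
    ...   | i , i<m , refl = s≤s z≤n , i<m

    record Basis : Set where
      field
        steps  : List ℕ
        few    : length steps ≤ h
        bounds : ∀ {d} → d ∈ steps → 0 < d × d ≤ m
        covers : ∀ c → 0 < c → c ≤ m → ∃[ d ] (d ∈ steps × Covers c d)

    class-basis : ∀ f → Flips f → length (filterᵇ f candidates) ≤ h → Basis
    class-basis f flips few = record
      { steps = filterᵇ f candidates ; few = few ; bounds = class-bounds f ; covers = class-covers f flips }

    -- The smaller of the two classes of χ (residues and non-residues in
    -- [1, m]) has at most m/2 = h elements.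
    basis : Basis
    basis with length (filterᵇ χ candidates) ≤? h
    ... | yes few = class-basis χ χ-flips few
    ... | no many = class-basis (not ∘ χ) (λ 0<c c≤m 0<d d≤m c~d → cong not (χ-flips 0<c c≤m 0<d d≤m c~d)) few
      where
      classes : length (filterᵇ χ candidates) + length (filterᵇ (not ∘ χ) candidates) ≡ h + h
      classes = trans (colour-classes χ candidates) (length-applyUpTo suc m)
      few : length (filterᵇ (not ∘ χ) candidates) ≤ h
      few = +-cancelˡ-≤ h _ h (≤-trans (+-monoˡ-≤ _ (<⇒≤ (≰⇒> many))) (≤-reflexive classes))

    open Basis basis public

    Linked : ℕ → ℕ → Set
    Linked X Y = ∃[ d ] ∃[ e ] (d ∈ steps × e ≤ 2 × X + e * d ≈ Y)

    -- Residues at difference c ∈ [1, m] are linked, in one order or the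
    -- other: c = d and c = 2d link X to Y, c = p − 2d links Y to X.
    linked-small : ∀ {X Y c} → 0 < c → c ≤ m → X + c ≈ Y → Linked X Y ⊎ Linked Y X
    linked-small {X} {Y} {c} 0<c c≤m X+c≈Y with covers c 0<c c≤m
    ... | d , d∈steps , inj₁ refl =
      inj₁ (d , 1 , d∈steps , s≤s z≤n , ≈-trans (≡⇒≈ (cong (X +_) (*-identityˡ d))) X+c≈Y)
    ... | d , d∈steps , inj₂ (inj₁ refl) = inj₁ (d , 2 , d∈steps , ≤-refl , X+c≈Y)
    ... | d , d∈steps , inj₂ (inj₂ 2d+c≡p) = inj₂ (d , 2 , d∈steps , ≤-refl , (begin
      Y + 2 * d          ≈⟨ +-cong X+c≈Y (≈-refl {2 * d}) ⟨
      X + c + 2 * d      ≡⟨ +-assoc X c (2 * d) ⟩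
      X + (c + 2 * d)    ≡⟨ cong (X +_) (trans (+-comm c (2 * d)) 2d+c≡p) ⟩
      X + p              ≈⟨ +-modulus X ⟩
      X                  ∎))
      where open ≈-Reasoning

    -- Every difference in [1, p − 1] is ±c with c ∈ [1, m].
    linked : ∀ {X Y c} → 0 < c → c < p → X + c ≈ Y → Linked X Y ⊎ Linked Y X
    linked {X} {Y} {c} 0<c c<p X+c≈Y with c ≤? m
    ... | yes c≤m = linked-small 0<c c≤m X+c≈Y
    ... | no  c≰m = swap (linked-small (m<n⇒0<n∸m c<p) p∸c≤m Y+[p∸c]≈X)
      where
      open ≈-Reasoning
      p∸c≤m : p ∸ c ≤ m
      p∸c≤m = ≤-trans (∸-monoʳ-≤ p (≰⇒> c≰m)) (≤-reflexive (m+n∸m≡n m m))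
      Y+[p∸c]≈X : Y + (p ∸ c) ≈ X
      Y+[p∸c]≈X = begin
        Y + (p ∸ c)        ≈⟨ +-cong X+c≈Y (≈-refl {p ∸ c}) ⟨
        X + c + (p ∸ c)    ≡⟨ +-assoc X c (p ∸ c) ⟩
        X + (c + (p ∸ c))  ≡⟨ cong (X +_) (m+[n∸m]≡n (<⇒≤ c<p)) ⟩
        X + p              ≈⟨ +-modulus X ⟩
        X                  ∎

    every-pair-linked : ∀ {X Y} → X < p → Y < p → X ≢ Y → Linked X Y ⊎ Linked Y X
    every-pair-linked {X} {Y} X<p Y<p X≢Y with <-cmp X Y
    ... | tri< X<Y _ _ = linked (m<n⇒0<n∸m X<Y) (≤-<-trans (m∸n≤m Y X) Y<p) (≡⇒≈ (m+[n∸m]≡n (<⇒≤ X<Y)))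
    ... | tri≈ _ X≡Y _ = ⊥-elim (X≢Y X≡Y)
    ... | tri> _ _ Y<X = swap (linked (m<n⇒0<n∸m Y<X) (≤-<-trans (m∸n≤m X Y) X<p) (≡⇒≈ (m+[n∸m]≡n (<⇒≤ Y<X))))

    open Walk k (length steps) (nth steps) public

    -- A link through the basis step d = nth steps j is realised in block j.
    linked⇒near : ∀ x y → Linked (toℕ x) (toℕ y) → Near walk x y
    linked⇒near x y (d , e , d∈steps , e≤2 , x+e*d≈y) with ∈⇒nth steps d∈steps
    ... | j , j<t , refl = walk-meets j<t e≤2 step-invertible x y x+e*d≈y
      where
      step-invertible : Invertible (nth steps j)
      step-invertible = invertible (proj₁ (bounds d∈steps)) (≤-<-trans (proj₂ (bounds d∈steps)) m<p)

    walk-radius : IsRadiusSeq p 2 size walk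
    walk-radius x y x≢y with every-pair-linked (toℕ<n x) (toℕ<n y) (x≢y ∘ toℕ-injective)
    ... | inj₁ x~y = linked⇒near x y x~y
    ... | inj₂ y~x = near-sym {a = walk} (linked⇒near y x y~x)

    -- With at most h blocks of p + 1 terms: 4(h(p + 1) + 1) = p² + 3 = 2·C(p, 2) + p + 3.
    size-bound : 4 * size ≤ 2 * (p C 2) + (p + 3)
    size-bound = begin
      4 * suc (length steps * N)  ≤⟨ *-monoʳ-≤ 4 (s≤s (*-monoˡ-≤ N few)) ⟩
      4 * suc (h * N)             ≡⟨ expand h ⟩
      p * k + (p + 3)             ≡⟨ cong (_+ (p + 3)) (double-choose-2 k) ⟨
      2 * (p C 2) + (p + 3)       ∎
      where
      open ≤-Reasoning
      expand : ∀ h → 4 * suc (h * suc (suc ((h + h) + (h + h))))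
                     ≡ suc ((h + h) + (h + h)) * ((h + h) + (h + h)) + (suc ((h + h) + (h + h)) + 3)
      expand = solve-∀

  radius-sequence : Prime p → k ^ h ≈ k →
    ∃[ M ] ∃[ a ] (IsRadiusSeq p 2 M a × 4 * M ≤ 2 * (p C 2) + (p + 3))
  radius-sequence p-prime k^h≈k = size , walk , walk-radius , size-bound
    where open DifferenceBasis p-prime (two-nonresidue p-prime k^h≈k)

-- p ≡ 5 (mod 8) means p = 4h + 1 with h = 2q + 1 odd, q = ⌊p/8⌋.
corollary4p2 : (p : ℕ) → Prime p → p % 8 ≡ 5 →
    ∃[ m ] ∃[ a ] (IsRadiusSeq p 2 m a × 4 * m ≤ 2 * (p C 2) + (p + 3))
corollary4p2 p p-prime p%8≡5 = subst ShortSequence 8q+5≡p (radius-sequence (subst Prime (sym 8q+5≡p) p-prime) (k^odd q))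
  where
  q : ℕ
  q = p / 8
  open QuarterPrime (suc (q + q)) using (radius-sequence; k^odd) renaming (p to 8q+5)
  ShortSequence : ℕ → Set
  ShortSequence n = ∃[ M ] ∃[ a ] (IsRadiusSeq n 2 M a × 4 * M ≤ 2 * (n C 2) + (n + 3))
  8q+5≡p : 8q+5 ≡ p
  8q+5≡p = begin
    8q+5            ≡⟨ expand q ⟩
    5 + q * 8       ≡⟨ cong (_+ q * 8) p%8≡5 ⟨
    p % 8 + q * 8   ≡⟨ m≡m%n+[m/n]*n p 8 ⟨
    p               ∎
    where
    open ≡-Reasoning
    expand : ∀ q → suc ((suc (q + q) + suc (q + q)) + (suc (q + q) + suc (q + q))) ≡ 5 + q * 8
    expand = solve-∀
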